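{- Let $0<t<1$ be rational and let $G$ be a snark with a $t$-flow-pair $(\varphi_2,\varphi_{p+q+1})$. Then the support $\{e : \varphi_2(e)\ne0\}$ of $\varphi_2$ is (the edge set of) a $2$-factor of $G$.
   Context: A snark is a $2$-connected simple cubic graph that is not $3$-edge-colourable. For a positive integer $k$, a $k$-flow on a graph $G=(V,E)$ is an orientation of the edges together with an integer-valued map $\varphi\colon E\to\mathbb{Z}$ with $|\varphi(e)|\le k-1$ for all edges (zero values allowed) satisfying flow conservation at every vertex. For a rational $0<t\le1$, a $t$-flow-pair of $G$ is a pair consisting of a $2$-flow $\varphi_2$ and a $(p+q+1)$-flow $\varphi_{p+q+1}$ with the same orientation, for some positive integers $p,q$ with $t=p/q$, such that for every edge $e$, if $\varphi_2(e)=0$ then $|\varphi_{p+q+1}(e)|\ge q$. -}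

module Defs where

open import Data.Nat as ℕ using (ℕ; zero; suc; _∸_; NonZero)
open import Data.Integer as ℤ using (ℤ; +_; ∣_∣)
open import Data.Rational as ℚ using (ℚ)
open import Data.Fin using (Fin; zero; suc; _≟_)
open import Data.Bool using (Bool; true; false; if_then_else_; _∧_; not)
open import Data.Product using (Σ; ∃; _×_; _,_)
open import Data.Sum using (_⊎_)
open import Data.Unit using (⊤)
open import Relation.Nullary using (¬_; Dec; yes; no)
open import Relation.Nullary.Decidable using (⌊_⌋)
open import Relation.Binary.PropositionalEquality using (_≡_; _≢_)

sumℤ : (m : ℕ) → (Fin m → ℤ) → ℤ
sumℤ zero f = + 0
sumℤ (suc m) f = f zero ℤ.+ sumℤ m (λ i → f (suc i))

countB : (m : ℕ) → (Fin m → Bool) → ℕ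
countB zero f = 0
countB (suc m) f = (if f zero then 1 else 0) ℕ.+ countB m (λ i → f (suc i))

record Graph : Set where
  field
    n : ℕ
    m : ℕ
    end₁ : Fin m → Fin n
    end₂ : Fin m → Fin n

module _ (G : Graph) where
  open Graph G

  Incident : Fin m → Fin n → Set
  Incident e v = end₁ e ≡ v ⊎ end₂ e ≡ v

  incident? : Fin m → Fin n → Bool
  incident? e v = ⌊ end₁ e ≟ v ⌋ Data.Bool.∨ ⌊ end₂ e ≟ v ⌋

  degree : Fin n → ℕ
  degree v = countB m (λ e → incident? e v)

  -- no loops and no parallel edges
  Simple : Set
  Simple = (∀ e → end₁ e ≢ end₂ e)
         × (∀ e e' → (∀ v → Incident e v → Incident e' v) → (∀ v → Incident e' v → Incident e v) → e ≡ e')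

  Cubic : Set
  Cubic = ∀ v → degree v ≡ 3

  Adj : Fin m → Fin n → Fin n → Set
  Adj e x y = (end₁ e ≡ x × end₂ e ≡ y) ⊎ (end₂ e ≡ x × end₁ e ≡ y)

  -- walks from x to y all of whose vertices after x satisfy ok
  data Reach (ok : Fin n → Set) : Fin n → Fin n → Set where
    here : ∀ {x} → Reach ok x x
    step : ∀ {x y z} (e : Fin m) → Adj e x y → ok y → Reach ok y z → Reach ok x z

  Connected : Set
  Connected = ∀ x y → Reach (λ _ → ⊤) x y

  TwoConnected : Set
  TwoConnected = (3 ℕ.≤ n) × Connected
               × (∀ z x y → x ≢ z → y ≢ z → Reach (λ w → w ≢ z) x y)

  ThreeEdgeColourable : Set
  ThreeEdgeColourable = Σ (Fin m → Fin 3) λ c →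
    ∀ e e' → e ≢ e' → (∃ λ v → Incident e v × Incident e' v) → c e ≢ c e'

  Snark : Set
  Snark = TwoConnected × Simple × Cubic × ¬ ThreeEdgeColourable

  Orientation : Set
  Orientation = Fin m → Bool

  tail head : Orientation → Fin m → Fin n
  tail o e = if o e then end₁ e else end₂ e
  head o e = if o e then end₂ e else end₁ e

  netOut : Orientation → (Fin m → ℤ) → Fin n → ℤ
  netOut o φ v = sumℤ m (λ e → (if ⌊ tail o e ≟ v ⌋ then φ e else + 0)
                              ℤ.- (if ⌊ head o e ≟ v ⌋ then φ e else + 0))

  IsFlow : ℕ → Orientation → (Fin m → ℤ) → Set
  IsFlow k o φ = (∀ e → ∣ φ e ∣ ℕ.≤ k ∸ 1) × (∀ v → netOut o φ v ≡ + 0)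

  record TFlowPair (t : ℚ) : Set where
    field
      o : Orientation
      φ₂ : Fin m → ℤ
      φ' : Fin m → ℤ
      p q : ℕ
      p-pos : 1 ℕ.≤ p
      q-pos : NonZero q
      t≡p/q : t ≡ ℚ._/_ (+ p) q {{q-pos}}
      flow₂ : IsFlow 2 o φ₂
      flow' : IsFlow (p ℕ.+ q ℕ.+ 1) o φ'
      pairCond : ∀ e → φ₂ e ≡ + 0 → q ℕ.≤ ∣ φ' e ∣

  support : (Fin m → ℤ) → Fin m → Bool
  support φ e = not ⌊ φ e ℤ.≟ + 0 ⌋

  IsTwoFactor : (Fin m → Bool) → Set
  IsTwoFactor S = ∀ v → countB m (λ e → S e ∧ incident? e v) ≡ 2

-- At a vertex v of degree 3 the signed values of φ₂ on the three incident edges lie in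
-- {-1, 0, 1} and sum to 0, so either exactly two of them or none are nonzero.  If none
-- were, the signed values of the (p+q+1)-flow on these edges would all have absolute value
-- in [q, p+q] and sum to 0; but two of them have the same sign, so their sum has absolute
-- value at least 2q > p + q, too large to be cancelled by the third.

module Submission where

open import Defs
open import Data.Rational using (ℚ; 0ℚ; 1ℚ; _<_)

open import Data.Nat as ℕ using (ℕ; zero; suc; NonZero; s≤s)
open import Data.Nat.GCD using (gcd)
import Data.Nat.Properties as ℕP
open import Data.Integer as ℤ using (ℤ; +_; -[1+_]; ∣_∣)
import Data.Integer.Properties as ℤP
import Data.Rational as ℚ
import Data.Rational.Properties as ℚP
open import Algebra.Properties.AbelianGroup ℤP.+-0-abelianGroup using (inverseˡ-unique)
open import Algebra.Properties.CommutativeSemigroup ℤP.+-commutativeSemigroup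
  using (x∙yz≈yz∙x)
open import Data.Fin using (Fin; zero; suc; _≟_)
open import Data.Bool using (Bool; true; false; if_then_else_; _∧_; not)
import Data.Bool.Properties as BP
open import Data.List as List using (List; []; _∷_; length)
import Data.List.Properties as LP
open import Data.List.Relation.Unary.All using (All; []; _∷_)
import Data.List.Relation.Unary.All.Properties as AllP
open import Data.Product using (_×_; _,_; proj₁; proj₂)
open import Data.Sum using (_⊎_; inj₁; inj₂)
open import Function using (_∘_)
open import Relation.Nullary using (yes; no; contradiction)
open import Relation.Nullary.Decidable using (⌊_⌋)
open import Relation.Binary.PropositionalEquality

m/n<1⇒m<n : ∀ m n .{{_ : NonZero n}} → (+ m ℚ./ n) < 1ℚ → m ℕ.< n
m/n<1⇒m<n m n r<1 = scaled (gcd m n) (ℚP.↥-/ (+ m) n) (ℚP.↧-/ (+ m) n)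
  where
  r = + m ℚ./ n
  ↥r<↧r : ℚ.↥ r ℤ.< ℚ.↧ r
  ↥r<↧r = subst₂ ℤ._<_ (ℤP.*-identityʳ _) (ℤP.*-identityˡ _) (ℚP.drop-*<* r<1)
  scaled : ∀ g → ℚ.↥ r ℤ.* + g ≡ + m → ℚ.↧ r ℤ.* + g ≡ + n → m ℕ.< n
  scaled zero    _       ↧r*0≡n =
    contradiction (sym (ℤP.+-injective (trans (sym (ℤP.*-zeroʳ (ℚ.↧ r))) ↧r*0≡n)))
                  (ℕ.≢-nonZero⁻¹ n)
  scaled (suc g) ↥r*g≡m ↧r*g≡n =
    ℤP.drop‿+<+ (subst₂ ℤ._<_ ↥r*g≡m ↧r*g≡n (ℤP.*-monoʳ-<-pos (+ suc g) ↥r<↧r))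

∑ : List ℤ → ℤ
∑ = List.foldr ℤ._+_ (+ 0)

countTrue : List Bool → ℕ
countTrue []       = 0
countTrue (b ∷ bs) = (if b then 1 else 0) ℕ.+ countTrue bs

nonzero : ℤ → Bool
nonzero a = not ⌊ a ℤ.≟ + 0 ⌋

nonzero-∣∣ : ∀ a → nonzero a ≡ nonzero (+ ∣ a ∣)
nonzero-∣∣ (+ _)    = refl
nonzero-∣∣ -[1+ _ ] = refl

nonzero-cong-∣∣ : ∀ {a b} → ∣ a ∣ ≡ ∣ b ∣ → nonzero a ≡ nonzero b
nonzero-cong-∣∣ {a} {b} ∣a∣≡∣b∣ =
  trans (nonzero-∣∣ a) (trans (cong (λ k → nonzero (+ k)) ∣a∣≡∣b∣) (sym (nonzero-∣∣ b)))

∣i-0∣≡∣i∣ : ∀ i → ∣ i ℤ.- + 0 ∣ ≡ ∣ i ∣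
∣i-0∣≡∣i∣ i = cong ∣_∣ (ℤP.+-identityʳ i)

∣0-i∣≡∣i∣ : ∀ i → ∣ + 0 ℤ.- i ∣ ≡ ∣ i ∣
∣0-i∣≡∣i∣ i = trans (cong ∣_∣ (ℤP.+-identityˡ (ℤ.- i))) (ℤP.∣-i∣≡∣i∣ i)

zero-sum⇒∣a+b∣≡∣c∣ : ∀ a b c → ∑ (a ∷ b ∷ c ∷ []) ≡ + 0 → ∣ a ℤ.+ b ∣ ≡ ∣ c ∣
zero-sum⇒∣a+b∣≡∣c∣ a b c s = trans (cong ∣_∣ a+b≡-c) (ℤP.∣-i∣≡∣i∣ c)
  where
  a+b≡-c : a ℤ.+ b ≡ ℤ.- c
  a+b≡-c = inverseˡ-unique (a ℤ.+ b) c
    (trans (ℤP.+-assoc a b c) (trans (cong (λ x → a ℤ.+ (b ℤ.+ x)) (sym (ℤP.+-identityʳ c))) s))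

sum-rotate : ∀ a b c → ∑ (a ∷ b ∷ c ∷ []) ≡ ∑ (b ∷ c ∷ a ∷ [])
sum-rotate a b c = begin
  a ℤ.+ (b ℤ.+ (c ℤ.+ + 0))  ≡⟨ x∙yz≈yz∙x a b (c ℤ.+ + 0) ⟩
  b ℤ.+ (c ℤ.+ + 0) ℤ.+ a    ≡⟨ ℤP.+-assoc b (c ℤ.+ + 0) a ⟩
  b ℤ.+ (c ℤ.+ + 0 ℤ.+ a)    ≡⟨ cong (λ x → b ℤ.+ (x ℤ.+ a)) (ℤP.+-identityʳ c) ⟩
  b ℤ.+ (c ℤ.+ a)            ≡⟨ cong (λ x → b ℤ.+ (c ℤ.+ x)) (sym (ℤP.+-identityʳ a)) ⟩
  b ℤ.+ (c ℤ.+ (a ℤ.+ + 0))  ∎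
  where open ≡-Reasoning

data SameSign : ℤ → ℤ → Set where
  nonneg : ∀ {m n} → SameSign (+ m) (+ n)
  neg    : ∀ {m n} → SameSign -[1+ m ] -[1+ n ]

two-of-three-sameSign : ∀ a b c → SameSign a b ⊎ SameSign b c ⊎ SameSign c a
two-of-three-sameSign (+ _)    (+ _)    _        = inj₁ nonneg
two-of-three-sameSign -[1+ _ ] -[1+ _ ] _        = inj₁ neg
two-of-three-sameSign (+ _)    -[1+ _ ] (+ _)    = inj₂ (inj₂ nonneg)
two-of-three-sameSign (+ _)    -[1+ _ ] -[1+ _ ] = inj₂ (inj₁ neg)
two-of-three-sameSign -[1+ _ ] (+ _)    (+ _)    = inj₂ (inj₁ nonneg)
two-of-three-sameSign -[1+ _ ] (+ _)    -[1+ _ ] = inj₂ (inj₂ neg)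

∣+∣-sameSign : ∀ {a b} → SameSign a b → ∣ a ℤ.+ b ∣ ≡ ∣ a ∣ ℕ.+ ∣ b ∣
∣+∣-sameSign nonneg        = refl
∣+∣-sameSign (neg {m} {n}) = cong suc (sym (ℕP.+-suc m n))

InBand : ℕ → ℕ → ℤ → Set
InBand p q b = q ℕ.≤ ∣ b ∣ × ∣ b ∣ ℕ.≤ p ℕ.+ q

module _ {p q : ℕ} (p<q : p ℕ.< q) where

  sameSign-sum-escapes-band : ∀ {a b} → SameSign a b → InBand p q a → InBand p q b →
                              p ℕ.+ q ℕ.< ∣ a ℤ.+ b ∣
  sameSign-sum-escapes-band {a} {b} s (q≤∣a∣ , _) (q≤∣b∣ , _) = begin-strict
    p ℕ.+ q        <⟨ ℕP.+-monoˡ-< q p<q ⟩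
    q ℕ.+ q        ≤⟨ ℕP.+-mono-≤ q≤∣a∣ q≤∣b∣ ⟩
    ∣ a ∣ ℕ.+ ∣ b ∣ ≡⟨ sym (∣+∣-sameSign s) ⟩
    ∣ a ℤ.+ b ∣    ∎
    where open ℕP.≤-Reasoning

  no-zero-sum-in-band-with-sameSign : ∀ a b c → SameSign a b →
    InBand p q a → InBand p q b → InBand p q c → ∑ (a ∷ b ∷ c ∷ []) ≢ + 0
  no-zero-sum-in-band-with-sameSign a b c sab ia ib (_ , ∣c∣≤p+q) sum≡0 = ℕP.<⇒≱
    (sameSign-sum-escapes-band sab ia ib)
    (ℕP.≤-trans (ℕP.≤-reflexive (zero-sum⇒∣a+b∣≡∣c∣ a b c sum≡0)) ∣c∣≤p+q)

  no-zero-sum-in-band : ∀ a b c → InBand p q a → InBand p q b → InBand p q c →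
                        ∑ (a ∷ b ∷ c ∷ []) ≢ + 0
  no-zero-sum-in-band a b c ia ib ic s with two-of-three-sameSign a b c
  ... | inj₁ ab        = no-zero-sum-in-band-with-sameSign a b c ab ia ib ic s
  ... | inj₂ (inj₁ bc) =
    no-zero-sum-in-band-with-sameSign b c a bc ib ic ia (trans (sym (sum-rotate a b c)) s)
  ... | inj₂ (inj₂ ca) =
    no-zero-sum-in-band-with-sameSign c a b ca ic ia ib (trans (sum-rotate c a b) s)

data Trit : ℤ → Set where
  zero  : Trit (+ 0)
  plus  : Trit (+ 1)
  minus : Trit -[1+ 0 ]

trit : ∀ a → ∣ a ∣ ℕ.≤ 1 → Trit a
trit (+ 0)            _         = zero
trit (+ 1)            _         = plus
trit (+ suc (suc _))  (s≤s ())
trit -[1+ 0 ]         _         = minus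
trit -[1+ suc _ ]     (s≤s ())

AllZero : ℤ → ℤ → ℤ → Set
AllZero a b c = a ≡ + 0 × b ≡ + 0 × c ≡ + 0

trits-zero-sum : ∀ {a b c} → Trit a → Trit b → Trit c → ∑ (a ∷ b ∷ c ∷ []) ≡ + 0 →
                 AllZero a b c ⊎ countTrue (List.map nonzero (a ∷ b ∷ c ∷ [])) ≡ 2
trits-zero-sum zero  zero  zero  _  = inj₁ (refl , refl , refl)
trits-zero-sum zero  plus  minus _  = inj₂ refl
trits-zero-sum zero  minus plus  _  = inj₂ refl
trits-zero-sum plus  zero  minus _  = inj₂ refl
trits-zero-sum minus zero  plus  _  = inj₂ refl
trits-zero-sum plus  minus zero  _  = inj₂ refl
trits-zero-sum minus plus  zero  _  = inj₂ refl
trits-zero-sum zero  zero  plus  ()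
trits-zero-sum zero  zero  minus ()
trits-zero-sum zero  plus  zero  ()
trits-zero-sum zero  plus  plus  ()
trits-zero-sum zero  minus zero  ()
trits-zero-sum zero  minus minus ()
trits-zero-sum plus  zero  zero  ()
trits-zero-sum plus  zero  plus  ()
trits-zero-sum plus  plus  zero  ()
trits-zero-sum plus  plus  plus  ()
trits-zero-sum plus  plus  minus ()
trits-zero-sum plus  minus plus  ()
trits-zero-sum plus  minus minus ()
trits-zero-sum minus zero  zero  ()
trits-zero-sum minus zero  minus ()
trits-zero-sum minus plus  plus  ()
trits-zero-sum minus plus  minus ()
trits-zero-sum minus minus zero  ()
trits-zero-sum minus minus plus  ()
trits-zero-sum minus minus minus ()

-- The constraints a t-flow-pair puts on the pair (φ₂ e, φ' e), read with a common sign.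
record PairValue (p q : ℕ) (a b : ℤ) : Set where
  field
    small   : ∣ a ∣ ℕ.≤ 1
    bounded : ∣ b ∣ ℕ.≤ p ℕ.+ q
    large   : a ≡ + 0 → q ℕ.≤ ∣ b ∣

pairValue-inBand : ∀ {p q a b} → PairValue p q a b → a ≡ + 0 → InBand p q b
pairValue-inBand v a≡0 = PairValue.large v a≡0 , PairValue.bounded v

pairValues-zero-sum : ∀ {p q a₁ a₂ a₃ b₁ b₂ b₃} → p ℕ.< q →
  PairValue p q a₁ b₁ → PairValue p q a₂ b₂ → PairValue p q a₃ b₃ →
  ∑ (a₁ ∷ a₂ ∷ a₃ ∷ []) ≡ + 0 → ∑ (b₁ ∷ b₂ ∷ b₃ ∷ []) ≡ + 0 →
  countTrue (List.map nonzero (a₁ ∷ a₂ ∷ a₃ ∷ [])) ≡ 2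
pairValues-zero-sum {a₁ = a₁} {a₂} {a₃} {b₁} {b₂} {b₃} p<q v₁ v₂ v₃ ∑a≡0 ∑b≡0
  with trits-zero-sum (trit a₁ (PairValue.small v₁)) (trit a₂ (PairValue.small v₂))
                      (trit a₃ (PairValue.small v₃)) ∑a≡0
... | inj₂ two                   = two
... | inj₁ (a₁≡0 , a₂≡0 , a₃≡0) = contradiction ∑b≡0 (no-zero-sum-in-band p<q b₁ b₂ b₃
  (pairValue-inBand v₁ a₁≡0) (pairValue-inBand v₂ a₂≡0) (pairValue-inBand v₃ a₃≡0))

selected : (k : ℕ) → (Fin k → Bool) → List (Fin k)
selected zero    f = []
selected (suc k) f =
  if f zero then zero ∷ rest else rest
  where rest = List.map suc (selected k (λ i → f (suc i)))

length-selected : ∀ k f → length (selected k f) ≡ countB k f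
length-selected zero    f = refl
length-selected (suc k) f with f zero
... | true  = cong suc (trans (LP.length-map suc (selected k _)) (length-selected k _))
... | false = trans (LP.length-map suc (selected k _)) (length-selected k _)

selected-true : ∀ k f → All (λ x → f x ≡ true) (selected k f)
selected-true zero    f = []
selected-true (suc k) f with f zero in fzero
... | true  = fzero ∷ AllP.map⁺ (selected-true k _)
... | false = AllP.map⁺ (selected-true k _)

sumℤ-selected : ∀ k f (g : Fin k → ℤ) → (∀ x → f x ≡ false → g x ≡ + 0) →
                sumℤ k g ≡ ∑ (List.map g (selected k f))
sumℤ-selected zero    f g g-off = refl
sumℤ-selected (suc k) f g g-off with f zero in fzero
... | true  = cong (λ x → g zero ℤ.+ x) rest
  where rest = trans (sumℤ-selected k _ _ (λ x → g-off (suc x)))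
                     (cong ∑ (LP.map-∘ (selected k _)))
... | false = trans (cong (λ x → x ℤ.+ sumℤ k (λ i → g (suc i))) (g-off zero fzero))
                    (trans (ℤP.+-identityˡ _)
                           (trans (sumℤ-selected k _ _ (λ x → g-off (suc x)))
                                  (cong ∑ (LP.map-∘ (selected k _)))))

countB-∧-selected : ∀ k f (B : Fin k → Bool) →
                    countB k (λ x → B x ∧ f x) ≡ countTrue (List.map B (selected k f))
countB-∧-selected zero    f B = refl
countB-∧-selected (suc k) f B with f zero
... | true  = cong₂ ℕ._+_ (cong (λ b → if b then 1 else 0) (BP.∧-identityʳ (B zero))) rest
  where rest = trans (countB-∧-selected k _ _) (cong countTrue (LP.map-∘ (selected k _)))
... | false = cong₂ ℕ._+_ (cong (λ b → if b then 1 else 0) (BP.∧-zeroʳ (B zero))) rest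
  where rest = trans (countB-∧-selected k _ _) (cong countTrue (LP.map-∘ (selected k _)))

module _ (G : Graph) where
  open Graph G

  incidentEdges : Fin n → List (Fin m)
  incidentEdges v = selected m (λ e → incident? G e v)

  netOutAlong : Orientation G → (Fin m → ℤ) → Fin n → Fin m → ℤ
  netOutAlong o φ v e = (if ⌊ tail G o e ≟ v ⌋ then φ e else + 0)
                        ℤ.- (if ⌊ head G o e ≟ v ⌋ then φ e else + 0)

  netOutAlong-nonincident : ∀ o φ v e → incident? G e v ≡ false → netOutAlong o φ v e ≡ + 0
  netOutAlong-nonincident o φ v e e∌v with o e
  ... | true  with end₁ e ≟ v | end₂ e ≟ v
  ...   | no _  | no _  = refl
  netOutAlong-nonincident o φ v e () | true  | yes _ | _
  netOutAlong-nonincident o φ v e () | true  | no _  | yes _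
  netOutAlong-nonincident o φ v e e∌v | false with end₁ e ≟ v | end₂ e ≟ v
  ...   | no _  | no _  = refl
  netOutAlong-nonincident o φ v e () | false | yes _ | _
  netOutAlong-nonincident o φ v e () | false | no _  | yes _

  ∣netOutAlong∣ : ∀ o φ v e → incident? G e v ≡ true → end₁ e ≢ end₂ e →
                  ∣ netOutAlong o φ v e ∣ ≡ ∣ φ e ∣
  ∣netOutAlong∣ o φ v e e∋v nonloop with o e
  ... | true  with end₁ e ≟ v | end₂ e ≟ v
  ...   | yes ₁≡v | yes ₂≡v = contradiction (trans ₁≡v (sym ₂≡v)) nonloop
  ...   | yes _   | no _    = ∣i-0∣≡∣i∣ (φ e)
  ...   | no _    | yes _   = ∣0-i∣≡∣i∣ (φ e)
  ∣netOutAlong∣ o φ v e () nonloop | true  | no _ | no _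
  ∣netOutAlong∣ o φ v e e∋v nonloop | false with end₁ e ≟ v | end₂ e ≟ v
  ...   | yes ₁≡v | yes ₂≡v = contradiction (trans ₁≡v (sym ₂≡v)) nonloop
  ...   | yes _   | no _    = ∣0-i∣≡∣i∣ (φ e)
  ...   | no _    | yes _   = ∣i-0∣≡∣i∣ (φ e)
  ∣netOutAlong∣ o φ v e () nonloop | false | no _ | no _

  netOut≡∑incidentEdges : ∀ o φ v →
                          netOut G o φ v ≡ ∑ (List.map (netOutAlong o φ v) (incidentEdges v))
  netOut≡∑incidentEdges o φ v =
    sumℤ-selected m _ (netOutAlong o φ v) (netOutAlong-nonincident o φ v)

  module _ {t : ℚ} (fp : TFlowPair G t) (p<q : TFlowPair.p fp ℕ.< TFlowPair.q fp)
           (loopless : ∀ e → end₁ e ≢ end₂ e) where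
    open TFlowPair fp

    pairValue-along : ∀ v e → incident? G e v ≡ true →
                      PairValue p q (netOutAlong o φ₂ v e) (netOutAlong o φ' v e)
    pairValue-along v e e∋v = record
      { small   = subst (ℕ._≤ 1) (sym ∣a∣≡∣φ₂∣) (proj₁ flow₂ e)
      ; bounded = subst₂ ℕ._≤_ (sym ∣b∣≡∣φ'∣) (ℕP.m+n∸n≡m (p ℕ.+ q) 1) (proj₁ flow' e)
      ; large   = λ a≡0 → subst (q ℕ.≤_) (sym ∣b∣≡∣φ'∣)
                    (pairCond e (ℤP.∣i∣≡0⇒i≡0 (trans (sym ∣a∣≡∣φ₂∣) (cong ∣_∣ a≡0))))
      }
      where
      ∣a∣≡∣φ₂∣ = ∣netOutAlong∣ o φ₂ v e e∋v (loopless e)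
      ∣b∣≡∣φ'∣ = ∣netOutAlong∣ o φ' v e e∋v (loopless e)

    support-at-degree-3 : ∀ v → degree G v ≡ 3 →
                          countTrue (List.map (support G φ₂) (incidentEdges v)) ≡ 2
    support-at-degree-3 v deg≡3 = go (incidentEdges v) (trans (length-selected m _) deg≡3)
      (selected-true m _)
      (trans (sym (netOut≡∑incidentEdges o φ₂ v)) (proj₂ flow₂ v))
      (trans (sym (netOut≡∑incidentEdges o φ' v)) (proj₂ flow' v))
      where
      go : ∀ es → length es ≡ 3 → All (λ e → incident? G e v ≡ true) es →
           ∑ (List.map (netOutAlong o φ₂ v) es) ≡ + 0 →
           ∑ (List.map (netOutAlong o φ' v) es) ≡ + 0 →
           countTrue (List.map (support G φ₂) es) ≡ 2
      go (e₁ ∷ e₂ ∷ e₃ ∷ []) refl (i₁ ∷ i₂ ∷ i₃ ∷ []) ∑a≡0 ∑b≡0 = begin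
        countTrue (List.map (support G φ₂) (e₁ ∷ e₂ ∷ e₃ ∷ []))
          ≡⟨ cong countTrue (LP.map-cong-local {f = support G φ₂} {g = nonzero ∘ netOutAlong o φ₂ v}
               (same-support i₁ ∷ same-support i₂ ∷ same-support i₃ ∷ [])) ⟩
        countTrue (List.map (nonzero ∘ netOutAlong o φ₂ v) (e₁ ∷ e₂ ∷ e₃ ∷ []))
          ≡⟨ pairValues-zero-sum p<q (pairValue-along v e₁ i₁) (pairValue-along v e₂ i₂)
                                      (pairValue-along v e₃ i₃) ∑a≡0 ∑b≡0 ⟩
        2 ∎
        where
        open ≡-Reasoning
        same-support : ∀ {e} → incident? G e v ≡ true →
                       support G φ₂ e ≡ nonzero (netOutAlong o φ₂ v e)
        same-support {e} e∋v = nonzero-cong-∣∣ (sym (∣netOutAlong∣ o φ₂ v e e∋v (loopless e)))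

lemma23 : (G : Graph) (t : ℚ) → 0ℚ < t → t < 1ℚ → Snark G →
    (fp : TFlowPair G t) → IsTwoFactor G (support G (TFlowPair.φ₂ fp))
lemma23 G t _ t<1 (_ , (loopless , _) , cubic , _) fp v = begin
  countB m (λ e → support G φ₂ e ∧ incident? G e v)
    ≡⟨ countB-∧-selected m _ (support G φ₂) ⟩
  countTrue (List.map (support G φ₂) (incidentEdges G v))
    ≡⟨ support-at-degree-3 G fp p<q loopless v (cubic v) ⟩
  2 ∎
  where
  open Graph G
  open TFlowPair fp
  open ≡-Reasoning
  p<q : p ℕ.< q
  p<q = m/n<1⇒m<n p q {{q-pos}} (subst (_< 1ℚ) t≡p/q t<1)
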